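{- For $n\in\mathbb{N}$: (1) if $n\in\{1,2\}$ then $c(n)=\lceil\lg n\rceil+1$ and $h(n)=\lceil\lg n\rceil$; (2) if $n\geq 3$ then $c(n)\leq\lceil\lg n\rceil$ and $h(n)\leq\lceil\lg n\rceil-1$, and equality holds for infinitely many $n\geq3$.
   Context: $\lg$ denotes the base-2 logarithm. For $i\in\mathbb{N}$ and $n\in\mathbb{N}_0$, $d_i(n)=2^{i-1}-\left|(n\bmod 2^i)-2^{i-1}\right|$. $c(n)$ is the number of distinct values in $\{d_i(n):i\in\mathbb{N}\}$ and $h(n)=c(n)-1$; for $n\ge2$, $h(n)$ equals the number of pairs $(n_0,n_1)$ of integers with $n_0\ge n_1\ge1$, $n_0+n_1=n$ and $n_0-n_1=d_i(n)$ for some $i\in\{1,\ldots,\lceil\lg n\rceil\}$ (the hypercubic bipartitions of $n$). -}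

module Defs where

open import Data.Nat using (ℕ; zero; suc; _+_; _∸_; _^_; _≤_; ∣_-_∣)
open import Data.Nat.DivMod using (_%_)
open import Data.Nat.Properties using (m^n≢0)
open import Data.Product using (Σ; _×_; ∃-syntax)
open import Data.List using (List; length)
open import Data.List.Membership.Propositional using (_∈_)
open import Data.List.Relation.Unary.Unique.Propositional using (Unique)
open import Relation.Binary.PropositionalEquality using (_≡_)
open import Function.Bundles using (_⇔_)

-- d_i(n) = 2^(i-1) - | (n mod 2^i) - 2^(i-1) |, for i ≥ 1.
-- The index i ≥ 1 is written as suc j (j : ℕ), so d (suc j) n = 2^j - |(n mod 2^(j+1)) - 2^j|.
-- Truncated subtraction is exact here because n mod 2^(j+1) < 2^(j+1).
d : ℕ → ℕ → ℕ
d zero    n = 0  -- unused: indices start at 1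
d (suc j) n = 2 ^ j ∸ ∣ (_%_ n (2 ^ suc j) {{m^n≢0 2 (suc j)}}) - 2 ^ j ∣

InD : ℕ → ℕ → Set
InD n v = ∃[ j ] d (suc j) n ≡ v

-- "c(n) = k": the set D(n) is finite with exactly k elements, i.e. it is
-- enumerated by a duplicate-free list of length k.
CardD : ℕ → ℕ → Set
CardD n k = Σ (List ℕ) λ xs → Unique xs × ((∀ v → v ∈ xs ⇔ InD n v)) × length xs ≡ k

-- Write L = ⌈lg n⌉. Once 2^(i-1) ≥ n we have d_i(n) = n, so D(n) is the set of
-- values d_1(n), …, d_(L+1)(n), and c(n) ≤ L + 1. Since d_1, d_2, d_3 only depend
-- on n mod 8, a check of the eight residues shows d_1(n) = d_2(n) or
-- d_2(n) = d_3(n); for n ≥ 3 (so L ≥ 2) this costs one value, so c(n) ≤ L.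
-- Equality is attained by n = 0101…01₂ = (4^a − 1)/3 with a ≥ 2 ones: there
-- d_1(n) = d_2(n) = 1, the values d_2(n) < d_3(n) < … < d_(L+1)(n) = n strictly
-- increase, and L = 2a − 1.
module Submission where

open import Defs
open import Data.Nat using (ℕ; zero; suc; _+_; _*_; _∸_; _^_; _≤_; _<_; _≥_; _≰_; z≤n; s≤s; ∣_-_∣; ⌈_/2⌉; ⌊_/2⌋)
open import Data.Nat.Properties
open import Data.Nat.DivMod using (_%_; _/_; m≡m%n+[m/n]*n; [m+kn]%n≡m%n; m<n⇒m%n≡m; m%n<n)
open import Data.Nat.Induction using (<-rec)
open import Data.Nat.Logarithm using (⌈log₂_⌉; ⌈log₂⌉-mono-≤; ⌈log₂⌈n/2⌉⌉≡⌈log₂n⌉∸1; ⌈log₂2^n⌉≡n)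
open import Data.Nat.Tactic.RingSolver using (solve-∀)
open import Data.Product using (_×_; _,_; ∃-syntax)
open import Data.Sum using (_⊎_; inj₁; inj₂)
import Data.Sum as Sum
open import Data.List using (List; _∷_; length; applyUpTo; deduplicate)
open import Data.List.Properties using (length-applyUpTo; length-deduplicate; length-filter; filter-notAll)
open import Data.List.Membership.Propositional using (_∈_)
open import Data.List.Membership.Propositional.Properties
  using (∈-applyUpTo⁺; ∈-applyUpTo⁻; ∈-deduplicate⁺; ∈-deduplicate⁻)
open import Data.List.Relation.Unary.Any using (here; there)
import Data.List.Relation.Unary.Any as Any
import Data.List.Relation.Unary.AllPairs as AllPairs
open import Data.List.Relation.Unary.Linked using (Linked; []; [-]; _∷_)
open import Data.List.Relation.Unary.Linked.Properties using (Linked⇒AllPairs)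
open import Data.List.Relation.Unary.Unique.DecPropositional.Properties using (deduplicate-!)
open import Function.Bundles using (_⇔_; mk⇔)
open import Function.Construct.Composition using (_⇔-∘_)
open import Relation.Nullary using (¬?; yes; no)
open import Relation.Binary.PropositionalEquality

d-periodic : ∀ j r q → d (suc j) (r + q * 2 ^ suc j) ≡ d (suc j) r
d-periodic j r q = cong (λ t → 2 ^ j ∸ ∣ t - 2 ^ j ∣) ([m+kn]%n≡m%n r q (2 ^ suc j) {{m^n≢0 2 (suc j)}})

d-below : ∀ j n → n < 2 ^ suc j → d (suc j) n ≡ 2 ^ j ∸ ∣ n - 2 ^ j ∣
d-below j n n<2^j+1 = cong (λ t → 2 ^ j ∸ ∣ t - 2 ^ j ∣) (m<n⇒m%n≡m {{m^n≢0 2 (suc j)}} n<2^j+1)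

2^j<2^[j+1] : ∀ j → 2 ^ j < 2 ^ suc j
2^j<2^[j+1] j = ^-monoʳ-< 2 (s≤s (s≤s z≤n)) (n<1+n j)

d-stable : ∀ j n → n ≤ 2 ^ j → d (suc j) n ≡ n
d-stable j n n≤2^j = begin
  d (suc j) n             ≡⟨ d-below j n (≤-<-trans n≤2^j (2^j<2^[j+1] j)) ⟩
  2 ^ j ∸ ∣ n - 2 ^ j ∣   ≡⟨ cong (2 ^ j ∸_) (m≤n⇒∣m-n∣≡n∸m n≤2^j) ⟩
  2 ^ j ∸ (2 ^ j ∸ n)     ≡⟨ m∸[m∸n]≡n n≤2^j ⟩
  n                       ∎
  where open ≡-Reasoning

d-reflect : ∀ j x → x < 2 ^ j → d (suc j) (2 ^ j + x) ≡ 2 ^ j ∸ x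
d-reflect j x x<2^j = begin
  d (suc j) (2 ^ j + x)                ≡⟨ d-below j (2 ^ j + x) 2^j+x<2^[j+1] ⟩
  2 ^ j ∸ ∣ 2 ^ j + x - 2 ^ j ∣        ≡⟨ cong (2 ^ j ∸_) (trans (∣-∣-comm (2 ^ j + x) (2 ^ j)) (∣m-m+n∣≡n (2 ^ j) x)) ⟩
  2 ^ j ∸ x                            ∎
  where
  open ≡-Reasoning
  2^j+x<2^[j+1] : 2 ^ j + x < 2 ^ suc j
  2^j+x<2^[j+1] = subst (2 ^ j + x <_) (cong (2 ^ j +_) (sym (+-identityʳ (2 ^ j)))) (+-monoʳ-< (2 ^ j) x<2^j)

d-mod-8 : ∀ j c n → c * 2 ^ suc j ≡ 8 → d (suc j) n ≡ d (suc j) (n % 8)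
d-mod-8 j c n c*2^[j+1]≡8 = begin
  d (suc j) n                                   ≡⟨ cong (d (suc j)) (m≡m%n+[m/n]*n n 8) ⟩
  d (suc j) (n % 8 + n / 8 * 8)                 ≡⟨ cong (λ t → d (suc j) (n % 8 + t)) 8-as-multiple ⟩
  d (suc j) (n % 8 + n / 8 * c * 2 ^ suc j)     ≡⟨ d-periodic j (n % 8) (n / 8 * c) ⟩
  d (suc j) (n % 8)                             ∎
  where
  open ≡-Reasoning
  8-as-multiple : n / 8 * 8 ≡ n / 8 * c * 2 ^ suc j
  8-as-multiple = trans (cong (n / 8 *_) (sym c*2^[j+1]≡8)) (sym (*-assoc (n / 8) c (2 ^ suc j)))

d₁≡d₂⊎d₂≡d₃ : ∀ n → d 1 n ≡ d 2 n ⊎ d 2 n ≡ d 3 n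
d₁≡d₂⊎d₂≡d₃ n = Sum.map (transport 0 4 1 2 refl refl) (transport 1 2 2 1 refl refl) (residues (n % 8) (m%n<n n 8))
  where
  transport : ∀ i a j b → a * 2 ^ suc i ≡ 8 → b * 2 ^ suc j ≡ 8 →
              d (suc i) (n % 8) ≡ d (suc j) (n % 8) → d (suc i) n ≡ d (suc j) n
  transport i a j b p q e = trans (d-mod-8 i a n p) (trans e (sym (d-mod-8 j b n q)))
  residues : ∀ r → r < 8 → d 1 r ≡ d 2 r ⊎ d 2 r ≡ d 3 r
  residues 0 _ = inj₁ refl
  residues 1 _ = inj₁ refl
  residues 2 _ = inj₂ refl
  residues 3 _ = inj₁ refl
  residues 4 _ = inj₁ refl
  residues 5 _ = inj₁ refl
  residues 6 _ = inj₂ refl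
  residues 7 _ = inj₁ refl
  residues (suc (suc (suc (suc (suc (suc (suc (suc _)))))))) (s≤s (s≤s (s≤s (s≤s (s≤s (s≤s (s≤s (s≤s ()))))))))

n≤2^⌈log₂n⌉ : ∀ n → n ≤ 2 ^ ⌈log₂ n ⌉
n≤2^⌈log₂n⌉ = <-rec (λ n → n ≤ 2 ^ ⌈log₂ n ⌉) step
  where
  ⌈n/2⌉≤2^k⇒n≤2^[k+1] : ∀ n k → ⌈ n /2⌉ ≤ 2 ^ k → n ≤ 2 ^ suc k
  ⌈n/2⌉≤2^k⇒n≤2^[k+1] n k h = begin
    n                   ≡⟨ sym (⌊n/2⌋+⌈n/2⌉≡n n) ⟩
    ⌊ n /2⌋ + ⌈ n /2⌉   ≤⟨ +-monoˡ-≤ ⌈ n /2⌉ (⌊n/2⌋≤⌈n/2⌉ n) ⟩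
    ⌈ n /2⌉ + ⌈ n /2⌉   ≤⟨ +-mono-≤ h h ⟩
    2 ^ k + 2 ^ k       ≡⟨ cong (2 ^ k +_) (sym (+-identityʳ (2 ^ k))) ⟩
    2 ^ suc k           ∎
    where open ≤-Reasoning
  step : ∀ n → (∀ {m} → m < n → m ≤ 2 ^ ⌈log₂ m ⌉) → n ≤ 2 ^ ⌈log₂ n ⌉
  step 0 _ = z≤n
  step 1 _ = s≤s z≤n
  -- For n ≥ 2, ⌈log₂ n ⌉ reduces to a successor, so 2 ^ suc (⌈log₂ n ⌉ ∸ 1) is 2 ^ ⌈log₂ n ⌉.
  step n@(suc (suc k)) ih = ⌈n/2⌉≤2^k⇒n≤2^[k+1] n (⌈log₂ n ⌉ ∸ 1)
    (subst (λ e → ⌈ n /2⌉ ≤ 2 ^ e) (⌈log₂⌈n/2⌉⌉≡⌈log₂n⌉∸1 n) (ih (⌈n/2⌉<n k)))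

⌈log₂⌉≡ : ∀ {n k} → 2 ^ k < n → n ≤ 2 ^ suc k → ⌈log₂ n ⌉ ≡ suc k
⌈log₂⌉≡ {n} {k} 2^k<n n≤2^[k+1] = ≤-antisym upper (≰⇒> lower)
  where
  upper : ⌈log₂ n ⌉ ≤ suc k
  upper = subst (⌈log₂ n ⌉ ≤_) (⌈log₂2^n⌉≡n (suc k)) (⌈log₂⌉-mono-≤ n≤2^[k+1])
  lower : ⌈log₂ n ⌉ ≰ k
  lower L≤k = <⇒≱ 2^k<n (≤-trans (n≤2^⌈log₂n⌉ n) (^-monoʳ-≤ 2 L≤k))

dValues : ℕ → ℕ → List ℕ
dValues n = applyUpTo (λ j → d (suc j) n)

∈-dValues⇔InD : ∀ {n L v} → n ≤ 2 ^ L → v ∈ dValues n (suc L) ⇔ InD n v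
∈-dValues⇔InD {n} {L} {v} n≤2^L = mk⇔ to from
  where
  to : v ∈ dValues n (suc L) → InD n v
  to v∈ with j , _ , refl ← ∈-applyUpTo⁻ (λ j → d (suc j) n) v∈ = j , refl
  from : InD n v → v ∈ dValues n (suc L)
  from (j , refl) with j ≤? L
  ... | yes j≤L = ∈-applyUpTo⁺ (λ j → d (suc j) n) (s≤s j≤L)
  ... | no j≰L = subst (_∈ dValues n (suc L)) dL≡dj (∈-applyUpTo⁺ (λ j → d (suc j) n) ≤-refl)
    where
    dL≡dj : d (suc L) n ≡ d (suc j) n
    dL≡dj = trans (d-stable L n n≤2^L)
      (sym (d-stable j n (≤-trans n≤2^L (^-monoʳ-≤ 2 (<⇒≤ (≰⇒> j≰L))))))

countD : ℕ → ℕ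
countD n = length (deduplicate _≟_ (dValues n (suc ⌈log₂ n ⌉)))

CardD-countD : ∀ n → CardD n (countD n)
CardD-countD n =
  deduplicate _≟_ xs , deduplicate-! _≟_ xs ,
  (λ v → ∈-dValues⇔InD (n≤2^⌈log₂n⌉ n) ⇔-∘ mk⇔ (∈-deduplicate⁻ _≟_ xs) (∈-deduplicate⁺ _≟_)) ,
  refl
  where
  xs : List ℕ
  xs = dValues n (suc ⌈log₂ n ⌉)

length-deduplicate-∷ : ∀ x xs → length (deduplicate _≟_ (x ∷ xs)) ≤ suc (length (deduplicate _≟_ xs))
length-deduplicate-∷ x xs = s≤s (length-filter (λ y → ¬? (x ≟ y)) (deduplicate _≟_ xs))

length-deduplicate-∷-∈ : ∀ {x xs} → x ∈ xs → length (deduplicate _≟_ (x ∷ xs)) ≤ length xs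
length-deduplicate-∷-∈ {x} {xs} x∈xs = ≤-trans
  (filter-notAll (λ y → ¬? (x ≟ y)) (deduplicate _≟_ xs) (Any.map (λ x≡y x≢y → x≢y x≡y) (∈-deduplicate⁺ _≟_ x∈xs)))
  (length-deduplicate _≟_ xs)

length-deduplicate-dValues≤ : ∀ n L → 2 ≤ L → length (deduplicate _≟_ (dValues n (suc L))) ≤ L
length-deduplicate-dValues≤ n 1 (s≤s ())
length-deduplicate-dValues≤ n (suc (suc L)) _ = Sum.[ drop-d₁ , drop-d₂ ]′ (d₁≡d₂⊎d₂≡d₃ n)
  where
  from₂ from₃ : List ℕ
  from₂ = applyUpTo (λ j → d (suc (suc j)) n) (suc (suc L))
  from₃ = applyUpTo (λ j → d (suc (suc (suc j))) n) (suc L)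
  drop-d₁ : d 1 n ≡ d 2 n → length (deduplicate _≟_ (d 1 n ∷ from₂)) ≤ suc (suc L)
  drop-d₁ d₁≡d₂ = subst (length (deduplicate _≟_ (d 1 n ∷ from₂)) ≤_)
    (length-applyUpTo (λ j → d (suc (suc j)) n) (suc (suc L)))
    (length-deduplicate-∷-∈ {xs = from₂} (here d₁≡d₂))
  drop-d₂ : d 2 n ≡ d 3 n → length (deduplicate _≟_ (d 1 n ∷ from₂)) ≤ suc (suc L)
  drop-d₂ d₂≡d₃ = ≤-trans (length-deduplicate-∷ (d 1 n) from₂)
    (s≤s (subst (length (deduplicate _≟_ from₂) ≤_)
      (length-applyUpTo (λ j → d (suc (suc (suc j))) n) (suc L))
      (length-deduplicate-∷-∈ {xs = from₃} (here d₂≡d₃))))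

-- repunit₄ a = (4^a − 1)/3, written 0101…01 (a ones) in binary.
repunit₄ : ℕ → ℕ
repunit₄ zero    = 0
repunit₄ (suc a) = 1 + 4 * repunit₄ a

2^[1+a+1+a]≡4*2^[a+a] : ∀ a → 2 ^ (suc a + suc a) ≡ 4 * 2 ^ (a + a)
2^[1+a+1+a]≡4*2^[a+a] a = trans (cong (λ k → 2 * 2 ^ k) (+-suc a a)) (sym (*-assoc 2 2 (2 ^ (a + a))))

2^[a+a]≡3*repunit₄+1 : ∀ a → 2 ^ (a + a) ≡ 3 * repunit₄ a + 1
2^[a+a]≡3*repunit₄+1 zero    = refl
2^[a+a]≡3*repunit₄+1 (suc a) = begin
  2 ^ (suc a + suc a)         ≡⟨ 2^[1+a+1+a]≡4*2^[a+a] a ⟩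
  4 * 2 ^ (a + a)             ≡⟨ cong (4 *_) (2^[a+a]≡3*repunit₄+1 a) ⟩
  4 * (3 * repunit₄ a + 1)    ≡⟨ expand (repunit₄ a) ⟩
  3 * repunit₄ (suc a) + 1    ∎
  where
  open ≡-Reasoning
  expand : ∀ x → 4 * (3 * x + 1) ≡ 3 * (1 + 4 * x) + 1
  expand = solve-∀

repunit₄-+ : ∀ a b → repunit₄ (a + b) ≡ repunit₄ a + repunit₄ b * 2 ^ (a + a)
repunit₄-+ zero    b = sym (*-identityʳ (repunit₄ b))
repunit₄-+ (suc a) b = begin
  1 + 4 * repunit₄ (a + b)                                   ≡⟨ cong (λ t → 1 + 4 * t) (repunit₄-+ a b) ⟩
  1 + 4 * (repunit₄ a + repunit₄ b * 2 ^ (a + a))            ≡⟨ distribute (repunit₄ a) (repunit₄ b) (2 ^ (a + a)) ⟩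
  1 + 4 * repunit₄ a + repunit₄ b * (4 * 2 ^ (a + a))        ≡⟨ cong (λ t → 1 + 4 * repunit₄ a + repunit₄ b * t) (sym (2^[1+a+1+a]≡4*2^[a+a] a)) ⟩
  1 + 4 * repunit₄ a + repunit₄ b * 2 ^ (suc a + suc a)      ∎
  where
  open ≡-Reasoning
  distribute : ∀ x y z → 1 + 4 * (x + y * z) ≡ 1 + 4 * x + y * (4 * z)
  distribute = solve-∀

repunit₄-suc-+ : ∀ a b → repunit₄ (suc a + b) ≡ repunit₄ (suc a) + repunit₄ b * 2 ^ suc (suc (a + a))
repunit₄-suc-+ a b = trans (repunit₄-+ (suc a) b) (cong (λ k → repunit₄ (suc a) + repunit₄ b * 2 ^ suc k) (+-suc a a))

repunit₄<2^[a+a] : ∀ a → repunit₄ a < 2 ^ (a + a)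
repunit₄<2^[a+a] a = subst (repunit₄ a <_) (trans (+-comm 1 (3 * repunit₄ a)) (sym (2^[a+a]≡3*repunit₄+1 a)))
  (s≤s (m≤n*m (repunit₄ a) 3))

repunit₄-suc≡2^[a+a]+repunit₄ : ∀ a → repunit₄ (suc a) ≡ 2 ^ (a + a) + repunit₄ a
repunit₄-suc≡2^[a+a]+repunit₄ a =
  trans (regroup (repunit₄ a)) (cong (_+ repunit₄ a) (sym (2^[a+a]≡3*repunit₄+1 a)))
  where
  regroup : ∀ x → 1 + 4 * x ≡ (3 * x + 1) + x
  regroup = solve-∀

repunit₄-suc≤2^[1+a+a] : ∀ a → repunit₄ (suc a) ≤ 2 ^ suc (a + a)
repunit₄-suc≤2^[1+a+a] a = subst (repunit₄ (suc a) ≤_) (sym 2^[1+a+a]≡) (m≤m+n (repunit₄ (suc a)) (2 * repunit₄ a + 1))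
  where
  regroup : ∀ x → 2 * (3 * x + 1) ≡ (1 + 4 * x) + (2 * x + 1)
  regroup = solve-∀
  2^[1+a+a]≡ : 2 ^ suc (a + a) ≡ repunit₄ (suc a) + (2 * repunit₄ a + 1)
  2^[1+a+a]≡ = trans (cong (2 *_) (2^[a+a]≡3*repunit₄+1 a)) (regroup (repunit₄ a))

d-repunit₄-odd : ∀ {a c} → a ≤ c → d (suc (a + a)) (repunit₄ (suc c)) ≡ 2 * repunit₄ a + 1
d-repunit₄-odd {a} a≤c with b , refl ← m≤n⇒∃[o]m+o≡n a≤c = begin
  d (suc j) (repunit₄ (suc a + b))                              ≡⟨ cong (d (suc j)) (repunit₄-suc-+ a b) ⟩
  d (suc j) (repunit₄ (suc a) + repunit₄ b * (2 * 2 ^ suc j))   ≡⟨ cong (λ t → d (suc j) (repunit₄ (suc a) + t)) (sym (*-assoc (repunit₄ b) 2 (2 ^ suc j))) ⟩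
  d (suc j) (repunit₄ (suc a) + repunit₄ b * 2 * 2 ^ suc j)     ≡⟨ d-periodic j (repunit₄ (suc a)) (repunit₄ b * 2) ⟩
  d (suc j) (repunit₄ (suc a))                                  ≡⟨ cong (d (suc j)) (repunit₄-suc≡2^[a+a]+repunit₄ a) ⟩
  d (suc j) (2 ^ j + repunit₄ a)                                ≡⟨ d-reflect j (repunit₄ a) (repunit₄<2^[a+a] a) ⟩
  2 ^ j ∸ repunit₄ a                                            ≡⟨ cong (_∸ repunit₄ a) (2^[a+a]≡3*repunit₄+1 a) ⟩
  3 * repunit₄ a + 1 ∸ repunit₄ a                               ≡⟨ cong (_∸ repunit₄ a) (regroup (repunit₄ a)) ⟩
  2 * repunit₄ a + 1 + repunit₄ a ∸ repunit₄ a                  ≡⟨ m+n∸n≡m (2 * repunit₄ a + 1) (repunit₄ a) ⟩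
  2 * repunit₄ a + 1                                            ∎
  where
  open ≡-Reasoning
  j : ℕ
  j = a + a
  regroup : ∀ x → 3 * x + 1 ≡ 2 * x + 1 + x
  regroup = solve-∀

d-repunit₄-even : ∀ {a c} → a ≤ c → d (suc (suc (a + a))) (repunit₄ (suc c)) ≡ repunit₄ (suc a)
d-repunit₄-even {a} a≤c with b , refl ← m≤n⇒∃[o]m+o≡n a≤c = begin
  d (suc j) (repunit₄ (suc a + b))                         ≡⟨ cong (d (suc j)) (repunit₄-suc-+ a b) ⟩
  d (suc j) (repunit₄ (suc a) + repunit₄ b * 2 ^ suc j)    ≡⟨ d-periodic j (repunit₄ (suc a)) (repunit₄ b) ⟩
  d (suc j) (repunit₄ (suc a))                             ≡⟨ d-stable j (repunit₄ (suc a)) (repunit₄-suc≤2^[1+a+a] a) ⟩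
  repunit₄ (suc a)                                         ∎
  where
  open ≡-Reasoning
  j : ℕ
  j = suc (a + a)

data Half : ℕ → Set where
  even : ∀ a → Half (a + a)
  odd  : ∀ a → Half (suc (a + a))

half : ∀ i → Half i
half 0 = even 0
half 1 = odd 0
half (suc (suc i)) with half i
... | even a = subst Half (cong suc (+-suc a a)) (even (suc a))
... | odd a  = subst Half (cong (λ k → suc (suc k)) (+-suc a a)) (odd (suc a))

m+m<n+n⇒m<n : ∀ {m n} → m + m < n + n → m < n
m+m<n+n⇒m<n m+m<n+n = ≰⇒> λ n≤m → <⇒≱ m+m<n+n (+-mono-≤ n≤m n≤m)

m+m≤n+n⇒m≤n : ∀ {m n} → m + m ≤ n + n → m ≤ n
m+m≤n+n⇒m≤n m+m≤n+n = ≮⇒≥ λ n<m → <⇒≱ (+-mono-< n<m n<m) m+m≤n+n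

d-repunit₄-increasing : ∀ {c i} → i < c + c →
  d (suc (suc i)) (repunit₄ (suc c)) < d (suc (suc (suc i))) (repunit₄ (suc c))
d-repunit₄-increasing {c} {i} i<c+c with half i
... | even a = begin-strict
  d (suc (suc (a + a))) n              ≡⟨ d-repunit₄-even (<⇒≤ a<c) ⟩
  repunit₄ (suc a)                     <⟨ x<2x+1 (repunit₄ (suc a)) ⟩
  2 * repunit₄ (suc a) + 1             ≡⟨ sym (d-repunit₄-odd a<c) ⟩
  d (suc (suc a + suc a)) n            ≡⟨ cong (λ k → d (suc (suc k)) n) (+-suc a a) ⟩
  d (suc (suc (suc (a + a)))) n        ∎
  where
  open ≤-Reasoning
  n : ℕ
  n = repunit₄ (suc c)
  a<c : a < c
  a<c = m+m<n+n⇒m<n i<c+c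
  x<2x+1 : ∀ x → x < 2 * x + 1
  x<2x+1 x = subst (x <_) (+-comm 1 (2 * x)) (s≤s (m≤n*m x 2))
... | odd a = begin-strict
  d (suc (suc (suc (a + a)))) n        ≡⟨ cong (λ k → d (suc (suc k)) n) (sym (+-suc a a)) ⟩
  d (suc (suc a + suc a)) n            ≡⟨ d-repunit₄-odd 1+a≤c ⟩
  2 * repunit₄ (suc a) + 1             <⟨ 2x+1<1+4x (repunit₄ (suc a)) (s≤s z≤n) ⟩
  repunit₄ (suc (suc a))               ≡⟨ sym (d-repunit₄-even 1+a≤c) ⟩
  d (suc (suc (suc a + suc a))) n      ≡⟨ cong (λ k → d (suc (suc (suc k))) n) (+-suc a a) ⟩
  d (suc (suc (suc (suc (a + a))))) n  ∎
  where
  open ≤-Reasoning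
  n : ℕ
  n = repunit₄ (suc c)
  1+a≤c : suc a ≤ c
  1+a≤c = m+m≤n+n⇒m≤n (subst (_≤ c + c) (cong suc (sym (+-suc a a))) i<c+c)
  2x+1<1+4x : ∀ x → 0 < x → 2 * x + 1 < 1 + 4 * x
  2x+1<1+4x x 0<x = subst (2 * x + 1 <_) (regroup x) (m<m+n (2 * x + 1) (≤-trans 0<x (m≤n*m x 2)))
    where
    regroup : ∀ x → 2 * x + 1 + 2 * x ≡ 1 + 4 * x
    regroup = solve-∀

applyUpTo-linked : ∀ {A : Set} {R : A → A → Set} (f : ℕ → A) m →
                   (∀ {i} → suc i < m → R (f i) (f (suc i))) → Linked R (applyUpTo f m)
applyUpTo-linked f 0             _    = []
applyUpTo-linked f 1             _    = [-]
applyUpTo-linked f (suc (suc m)) step = step (s≤s (s≤s z≤n)) ∷ applyUpTo-linked (λ i → f (suc i)) (suc m) (λ i<m → step (s≤s i<m))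

CardD-increasing : ∀ n L → ⌈log₂ n ⌉ ≡ suc L → d 1 n ≡ d 2 n →
                   Linked _<_ (applyUpTo (λ j → d (suc (suc j)) n) (suc L)) → CardD n ⌈log₂ n ⌉
CardD-increasing n L log≡ d₁≡d₂ increasing =
  xs , AllPairs.map <⇒≢ (Linked⇒AllPairs <-trans increasing) ,
  (λ v → ∈-dValues⇔InD n≤2^[1+L] ⇔-∘ mk⇔ there (drop-d₁ v)) ,
  trans (length-applyUpTo (λ j → d (suc (suc j)) n) (suc L)) (sym log≡)
  where
  xs : List ℕ
  xs = applyUpTo (λ j → d (suc (suc j)) n) (suc L)
  n≤2^[1+L] : n ≤ 2 ^ suc L
  n≤2^[1+L] = subst (λ e → n ≤ 2 ^ e) log≡ (n≤2^⌈log₂n⌉ n)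
  drop-d₁ : ∀ v → v ∈ d 1 n ∷ xs → v ∈ xs
  drop-d₁ v (here refl) = here d₁≡d₂
  drop-d₁ v (there v∈xs) = v∈xs

⌈log₂repunit₄⌉ : ∀ a → ⌈log₂ repunit₄ (suc (suc a)) ⌉ ≡ suc (suc a + suc a)
⌈log₂repunit₄⌉ a = ⌈log₂⌉≡ 2^[2a+2]<repunit₄ (repunit₄-suc≤2^[1+a+a] (suc a))
  where
  2^[2a+2]<repunit₄ : 2 ^ (suc a + suc a) < repunit₄ (suc (suc a))
  2^[2a+2]<repunit₄ = subst (2 ^ (suc a + suc a) <_) (sym (repunit₄-suc≡2^[a+a]+repunit₄ (suc a)))
    (m<m+n (2 ^ (suc a + suc a)) (s≤s z≤n))

CardD-repunit₄ : ∀ c → CardD (repunit₄ (suc (suc c))) ⌈log₂ repunit₄ (suc (suc c)) ⌉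
CardD-repunit₄ c = CardD-increasing n (suc c + suc c) (⌈log₂repunit₄⌉ c)
  (trans (d-repunit₄-odd {c = suc c} z≤n) (sym (d-repunit₄-even {c = suc c} z≤n)))
  (applyUpTo-linked (λ j → d (suc (suc j)) n) (suc (suc c + suc c)) (λ i<L → d-repunit₄-increasing {c = suc c} (≤-pred i<L)))
  where
  n : ℕ
  n = repunit₄ (suc (suc c))

n≤repunit₄ : ∀ n → n ≤ repunit₄ n
n≤repunit₄ zero    = z≤n
n≤repunit₄ (suc n) = s≤s (≤-trans (n≤repunit₄ n) (m≤m+n (repunit₄ n) (3 * repunit₄ n)))

5≤repunit₄ : ∀ a → 5 ≤ repunit₄ (suc (suc a))
5≤repunit₄ a = +-monoʳ-≤ 1 (*-monoʳ-≤ 4 (s≤s z≤n))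

mainTheorem8 :
    ((n : ℕ) → n ≥ 1 →
      ∃[ k ] (CardD n k
        × ((n ≡ 1 ⊎ n ≡ 2) → (k ≡ ⌈log₂ n ⌉ + 1) × (k ∸ 1 ≡ ⌈log₂ n ⌉))
        × (n ≥ 3 → (k ≤ ⌈log₂ n ⌉) × (k ∸ 1 ≤ ⌈log₂ n ⌉ ∸ 1))))
    × ((m : ℕ) → ∃[ n ] ∃[ k ] (n ≥ m × n ≥ 3 × CardD n k
        × (k ≡ ⌈log₂ n ⌉) × (k ∸ 1 ≡ ⌈log₂ n ⌉ ∸ 1)))
mainTheorem8 = (λ n _ → countD n , CardD-countD n , small n , large n) , repunit₄-witness
  where
  small : ∀ n → (n ≡ 1 ⊎ n ≡ 2) → (countD n ≡ ⌈log₂ n ⌉ + 1) × (countD n ∸ 1 ≡ ⌈log₂ n ⌉)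
  small _ (inj₁ refl) = refl , refl
  small _ (inj₂ refl) = refl , refl
  large : ∀ n → n ≥ 3 → (countD n ≤ ⌈log₂ n ⌉) × (countD n ∸ 1 ≤ ⌈log₂ n ⌉ ∸ 1)
  large n n≥3 = c≤L , ∸-monoˡ-≤ 1 c≤L
    where
    c≤L : countD n ≤ ⌈log₂ n ⌉
    c≤L = length-deduplicate-dValues≤ n ⌈log₂ n ⌉ (⌈log₂⌉-mono-≤ {3} n≥3)
  repunit₄-witness : ∀ m → ∃[ n ] ∃[ k ] (n ≥ m × n ≥ 3 × CardD n k × (k ≡ ⌈log₂ n ⌉) × (k ∸ 1 ≡ ⌈log₂ n ⌉ ∸ 1))
  repunit₄-witness m = repunit₄ (suc (suc m)) , ⌈log₂ repunit₄ (suc (suc m)) ⌉ ,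
    ≤-trans (m≤n+m m 2) (n≤repunit₄ (suc (suc m))) ,
    ≤-trans (s≤s (s≤s (s≤s z≤n))) (5≤repunit₄ m) ,
    CardD-repunit₄ m , refl , refl
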